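{- For every odd integer $n\ge 3$, $\bar{\tau}(K_2\,\Box\, C_n)=0$.
   Context: $K_2$ is the complete graph on two vertices and $C_n$ is the cycle graph on $n$ vertices. For graphs $G,H$, the Cartesian product $G\Box H$ has vertex set $V(G)\times V(H)$, with $(u_1,v_1)$ and $(u_2,v_2)$ adjacent iff ($u_1=u_2$ and $v_1v_2\in E(H)$) or ($u_1u_2\in E(G)$ and $v_1=v_2$). For a topology $\mathcal{T}$ on a finite set $X$, its underlying graph is the simple graph on $X$ in which distinct $x,y$ are adjacent iff $x\in\overline{\{y\}}$ or $y\in\overline{\{x\}}$. For a finite simple graph $G$, $\bar{\tau}(G)$ is the number of topologies on $V(G)$ whose underlying graph is exactly $G$. -}

module Defs where

open import Data.Bool using (Bool; true; false; _∧_; _∨_; not; if_then_else_)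
open import Data.Bool.Properties using () renaming (_≟_ to _≟B_)
open import Data.Nat using (ℕ; zero; suc; _+_; _*_; _%_; _≡ᵇ_)
open import Data.Fin using (Fin; toℕ; fromℕ<; remQuot)
open import Data.Fin.Properties using () renaming (_≟_ to _≟F_)
open import Data.Fin.Subset using (Subset; _∪_; _∩_; ⊥; ⊤)
open import Data.Vec using (Vec; []; _∷_; lookup)
open import Data.Vec.Properties using (≡-dec)
open import Data.List using (List; []; _∷_; map; _++_; length; filter; zip; allFin; concatMap)
open import Data.Bool.ListAction using (all; any)
open import Data.Product using (_×_; _,_; proj₁; proj₂)
open import Relation.Nullary.Decidable using (⌊_⌋)
open import Relation.Binary.PropositionalEquality using (_≡_)

-- Finite simple graphs on the vertex set Fin m, given by a Boolean
-- adjacency relation (symmetric and irreflexive for the graphs below).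

Graph : ℕ → Set
Graph m = Fin m → Fin m → Bool

_==F_ : ∀ {m} → Fin m → Fin m → Bool
i ==F j = ⌊ i ≟F j ⌋

K₂ : Graph 2
K₂ u v = not (u ==F v)

-- cycle graph on n vertices 0,1,…,n-1 : i ~ j iff j ≡ i+1 (mod n) or i ≡ j+1 (mod n)
-- (a genuine simple cycle for n ≥ 3)
C : (n : ℕ) → Graph n
C zero () _
C (suc k) i j = (toℕ j ≡ᵇ (suc (toℕ i) % suc k)) ∨ (toℕ i ≡ᵇ (suc (toℕ j) % suc k))

-- Cartesian product; the vertex set Fin a × Fin b is identified with
-- Fin (a * b) via the standard bijection remQuot / combine.
_□_ : ∀ {a b} → Graph a → Graph b → Graph (a * b)
_□_ {a} {b} G H x y with remQuot b x | remQuot b y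
... | (u₁ , v₁) | (u₂ , v₂) = ((u₁ ==F u₂) ∧ H v₁ v₂) ∨ (G u₁ u₂ ∧ (v₁ ==F v₂))

_==S_ : ∀ {m} → Subset m → Subset m → Bool
S ==S T = ⌊ ≡-dec _≟B_ S T ⌋

allSubsets : (m : ℕ) → List (Subset m)
allSubsets zero = [] ∷ []
allSubsets (suc m) = map (true ∷_) (allSubsets m) ++ map (false ∷_) (allSubsets m)

allBoolLists : ℕ → List (List Bool)
allBoolLists zero = [] ∷ []
allBoolLists (suc k) = map (true ∷_) (allBoolLists k) ++ map (false ∷_) (allBoolLists k)

-- A family of subsets of Fin m is encoded by its characteristic list F,
-- aligned with allSubsets m: the i-th subset belongs to the family iff
-- the i-th entry of F is true.
record Family (m : ℕ) : Set where
  constructor family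
  field bits : List Bool
open Family public

_∈F_ : ∀ {m} → Subset m → Family m → Bool
_∈F_ {m} S F = any (λ p → proj₁ p ∧ (proj₂ p ==S S)) (zip (bits F) (allSubsets m))

allFamilies : (m : ℕ) → List (Family m)
allFamilies m = map family (allBoolLists (length (allSubsets m)))

-- Topologies on the finite set Fin m: families of (open) sets containing
-- ∅ and Fin m and closed under binary unions and intersections (on a
-- finite set, this is equivalent to closure under arbitrary unions and
-- finite intersections).

isTopology : ∀ {m} → Family m → Bool
isTopology {m} F =
  (⊥ ∈F F) ∧ (⊤ ∈F F) ∧
  all (λ S → all (λ T →
        not ((S ∈F F) ∧ (T ∈F F)) ∨ (((S ∪ T) ∈F F) ∧ ((S ∩ T) ∈F F)))
      (allSubsets m))
    (allSubsets m)

-- x ∈ closure {y}  iff  every open set containing x contains y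
inClosureOf : ∀ {m} → Family m → Fin m → Fin m → Bool
inClosureOf {m} F x y =
  all (λ U → not ((U ∈F F) ∧ lookup U x) ∨ lookup U y) (allSubsets m)

hasUnderlyingGraph : ∀ {m} → Family m → Graph m → Bool
hasUnderlyingGraph {m} F G =
  all (λ x → all (λ y →
        (x ==F y) ∨ ⌊ G x y ≟B (inClosureOf F x y ∨ inClosureOf F y x) ⌋)
      (allFin m))
    (allFin m)

τ̄ : ∀ {m} → Graph m → ℕ
τ̄ {m} G = length (filter (λ F → isTopology F ∧ hasUnderlyingGraph F G ≟B true)
                        (allFamilies m))

module Submission where

-- For any family F of subsets of a finite set, the
-- specialisation relation  x ≤ y  :⇔  x ∈ cl{y}  is transitive, and if F
-- has underlying graph G then two distinct vertices are adjacent in G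
-- exactly when they are comparable.  So a graph with τ̄(G) ≠ 0 is a
-- comparability graph: it carries a transitive relation whose
-- comparability graph is G (a "transitive realisation").
--
-- The prism K₂ □ Cₙ (outer cycle a₀ … aₙ₋₁, inner cycle b₀ … bₙ₋₁,
-- rungs aₖbₖ) has no transitive realisation for odd n: the path
-- aₖ – aₖ₊₁ – aₖ₊₂ cannot be oriented consistently in one direction,
-- since the rung vertex bₖ₊₁ is adjacent to the middle vertex only and
-- transitivity would make it comparable to an end vertex.  Hence the
-- orientations of consecutive outer edges alternate, which is impossible
-- around a cycle of odd length.

open import Defs
open import Data.Nat using (ℕ; zero; suc; _+_; _*_; _%_; _≤_; _<_; s≤s; z≤n)
open import Data.Nat.Properties using (≡⇒≡ᵇ; <-cmp; m≢1+n+m; <⇒≱; ≤-pred; *-suc)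
open import Data.Nat.DivMod using (_mod_; %-distribˡ-+; m<n⇒m%n≡m; m%n<n; n%n≡0; [m+n]%n≡m%n)
open import Data.Bool using (Bool; true; false; _∧_; _∨_; not; T)
open import Data.Bool.Properties using (T-∨; T-∧; T-≡; not-¬; not-involutive) renaming (_≟_ to _≟B_)
open import Data.Fin using (Fin; toℕ; combine)
open import Data.Fin.Properties using (toℕ<n; remQuot-combine; toℕ-fromℕ<; toℕ-injective;
  combine-injectiveˡ; combine-injectiveʳ)
open import Data.Fin.Subset using (Subset)
open import Data.Vec using (lookup)
open import Data.List using (length; allFin)
open import Data.List.Properties using (filter-none)
open import Data.List.Relation.Unary.All as All using (All)
open import Data.List.Relation.Unary.All.Properties using (all⁺; all⁻)
open import Data.List.Membership.Propositional.Properties using (∈-allFin)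
open import Data.Product using (∃; _,_; _×_; proj₁; proj₂)
open import Data.Sum using (_⊎_; inj₁; inj₂)
open import Data.Empty using (⊥; ⊥-elim)
open import Function using (_∘_; Equivalence)
open import Relation.Binary using (tri<; tri≈; tri>)
open import Relation.Nullary using (¬_)
open import Relation.Nullary.Decidable using (toWitness; fromWitness)
open import Relation.Binary.PropositionalEquality using (_≡_; refl; sym; trans; cong; cong₂; subst; _≢_; module ≡-Reasoning)

record TransitiveRealisation {m : ℕ} (G : Graph m) : Set where
  field
    R             : Fin m → Fin m → Bool
    R-trans       : ∀ {x y z} → T (R x y) → T (R y z) → T (R x z)
    comparability : ∀ {x y} → x ≢ y → G x y ≡ (R x y ∨ R y x)

  comparable⇒adjacent : ∀ {x y} → x ≢ y → T (R x y) ⊎ T (R y x) → T (G x y)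
  comparable⇒adjacent x≢y c =
    subst T (sym (comparability x≢y)) (Equivalence.from T-∨ c)

  adjacent⇒comparable : ∀ {x y} → x ≢ y → T (G x y) → T (R x y) ⊎ T (R y x)
  adjacent⇒comparable x≢y adj =
    Equivalence.to T-∨ (subst T (comparability x≢y) adj)

  -- If w is adjacent to y but to neither x nor z, the path x → y → z
  -- cannot be R-directed: w would become comparable to x or to z.
  no-directed-path : ∀ {x y z w} → x ≢ w → y ≢ w → z ≢ w →
    ¬ T (G x w) → T (G y w) → ¬ T (G z w) → T (R x y) → T (R y z) → ⊥
  no-directed-path x≢w y≢w z≢w ¬xw yw ¬zw xy yz with adjacent⇒comparable y≢w yw
  ... | inj₁ y≤w = ¬xw (comparable⇒adjacent x≢w (inj₁ (R-trans xy y≤w)))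
  ... | inj₂ w≤y = ¬zw (comparable⇒adjacent z≢w (inj₂ (R-trans w≤y yz)))

implication-trans : ∀ o ux uy uz →
  T (not (o ∧ ux) ∨ uy) → T (not (o ∧ uy) ∨ uz) → T (not (o ∧ ux) ∨ uz)
implication-trans false ux    uy   uz _  _  = _
implication-trans true  false uy   uz _  _  = _
implication-trans true  true  true uz _  h = h

closure-trans : ∀ {m} (F : Family m) {x y z : Fin m} →
  T (inClosureOf F x y) → T (inClosureOf F y z) → T (inClosureOf F x z)
closure-trans {m} F {x} {y} {z} xy yz =
  all⁻ (openSetsThrough x z)
       (All.zipWith (λ {U} (p , q) → implication-trans (U ∈F F) (lookup U x) (lookup U y) (lookup U z) p q)
                    (all⁺ (openSetsThrough x y) (allSubsets m) xy , all⁺ (openSetsThrough y z) (allSubsets m) yz))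
  where
  openSetsThrough : Fin m → Fin m → Subset m → Bool
  openSetsThrough u v U = not ((U ∈F F) ∧ lookup U u) ∨ lookup U v

specialisation-realises : ∀ {m} (F : Family m) (G : Graph m) →
  T (hasUnderlyingGraph F G) → TransitiveRealisation G
specialisation-realises {m} F G hyp = record
  { R             = inClosureOf F
  ; R-trans       = closure-trans F
  ; comparability = adjacency
  }
  where
  adjacency : ∀ {x y} → x ≢ y → G x y ≡ (inClosureOf F x y ∨ inClosureOf F y x)
  adjacency {x} {y} x≢y
    with Equivalence.to (T-∨ {x ==F y})
           (All.lookup (all⁺ _ (allFin m) (All.lookup (all⁺ _ (allFin m) hyp) (∈-allFin x)))
                       (∈-allFin y))
  ... | inj₁ x≡y = ⊥-elim (x≢y (toWitness x≡y))
  ... | inj₂ eq  = toWitness eq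

τ̄-of-non-comparability : ∀ {m} (G : Graph m) → ¬ TransitiveRealisation G → τ̄ G ≡ 0
τ̄-of-non-comparability {m} G ¬real =
  cong length (filter-none (λ F → isTopology F ∧ hasUnderlyingGraph F G ≟B true) {allFamilies m}
                           (All.tabulate λ {F} _ → rejected F))
  where
  rejected : ∀ F → ¬ (isTopology F ∧ hasUnderlyingGraph F G ≡ true)
  rejected F top∧graph =
    ¬real (specialisation-realises F G
            (proj₂ (Equivalence.to (T-∧ {isTopology F}) (Equivalence.from T-≡ top∧graph))))


Alternating : (ℕ → Bool) → Set
Alternating f = ∀ k → f (suc k) ≡ not (f k)

alternating-even : ∀ f → Alternating f → ∀ j → f (2 * j) ≡ f 0
alternating-even f alt zero = refl
alternating-even f alt (suc j) = begin
  f (2 * suc j)            ≡⟨ cong f (*-suc 2 j) ⟩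
  f (suc (suc (2 * j)))    ≡⟨ alt (suc (2 * j)) ⟩
  not (f (suc (2 * j)))    ≡⟨ cong not (alt (2 * j)) ⟩
  not (not (f (2 * j)))    ≡⟨ not-involutive _ ⟩
  f (2 * j)                ≡⟨ alternating-even f alt j ⟩
  f 0                      ∎
  where open ≡-Reasoning

alternating-no-odd-period : ∀ f → Alternating f → ∀ j → f (1 + 2 * j) ≢ f 0
alternating-no-odd-period f alt j period =
  not-¬ (sym (trans (sym period) (trans (alt (2 * j)) (cong not (alternating-even f alt j))))) refl

□-combine : ∀ {p q} (G : Graph p) (H : Graph q) (u₁ u₂ : Fin p) (v₁ v₂ : Fin q) →
  (G □ H) (combine u₁ v₁) (combine u₂ v₂) ≡ (((u₁ ==F u₂) ∧ H v₁ v₂) ∨ (G u₁ u₂ ∧ (v₁ ==F v₂)))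
□-combine {p} {q} G H u₁ u₂ v₁ v₂ =
  cong₂ (λ (x y : Fin p × Fin q) →
           ((proj₁ x ==F proj₁ y) ∧ H (proj₂ x) (proj₂ y)) ∨ (G (proj₁ x) (proj₁ y) ∧ (proj₂ x ==F proj₂ y)))
        (remQuot-combine {p} {q} u₁ v₁) (remQuot-combine {p} {q} u₂ v₂)

-- The prism K₂ □ C N for N = n' + 2: its vertices are aₖ = (0, k mod N)
-- on the outer cycle and bₖ = (1, k mod N) on the inner one.
module Prism (n' : ℕ) where

  N : ℕ
  N = suc (suc n')

  prism : Graph (2 * N)
  prism = K₂ □ C N

  idx : ℕ → Fin N
  idx k = k mod N

  toℕ-idx : ∀ k → toℕ (idx k) ≡ k % N
  toℕ-idx k = toℕ-fromℕ< (m%n<n k N)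

  toℕ-idx-suc : ∀ k → toℕ (idx (suc k)) ≡ suc (toℕ (idx k)) % N
  toℕ-idx-suc k = begin
    toℕ (idx (suc k))          ≡⟨ toℕ-idx (suc k) ⟩
    (1 + k) % N                ≡⟨ %-distribˡ-+ 1 k N ⟩
    (1 % N + k % N) % N        ≡⟨ cong (λ t → (t + k % N) % N) (m<n⇒m%n≡m {n = N} (s≤s (s≤s z≤n))) ⟩
    suc (k % N) % N            ≡⟨ cong (λ t → suc t % N) (sym (toℕ-idx k)) ⟩
    suc (toℕ (idx k)) % N      ∎
    where open ≡-Reasoning

  -- the cyclic successor moves every point (this uses N ≥ 2)
  successor-moves : ∀ x → x < N → suc x % N ≢ x
  successor-moves x x<N sx≡x with <-cmp (suc x) N
  ... | tri< sx<N _ _ = m≢1+n+m x {0} (sym (trans (sym (m<n⇒m%n≡m sx<N)) sx≡x))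
  ... | tri≈ _ sx≡N _ = N≢1 (trans (sym sx≡N) (cong suc (trans (sym sx≡x) wraps)))
    where
    wraps : suc x % N ≡ 0
    wraps = trans (cong (_% N) sx≡N) (n%n≡0 N)
    N≢1 : N ≢ 1
    N≢1 ()
  ... | tri> _ _ sx>N = <⇒≱ x<N (≤-pred sx>N)

  idx-suc-≢ : ∀ k → idx k ≢ idx (suc k)
  idx-suc-≢ k eq = successor-moves (toℕ (idx k)) (toℕ<n (idx k))
    (sym (trans (cong toℕ eq) (toℕ-idx-suc k)))

  idx-periodic : ∀ k → idx (k + N) ≡ idx k
  idx-periodic k = toℕ-injective (trans (toℕ-idx (k + N))
                                    (trans ([m+n]%n≡m%n k N) (sym (toℕ-idx k))))

  a b : ℕ → Fin (2 * N)
  a k = combine {2} {N} Fin.zero (idx k)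
  b k = combine {2} {N} (Fin.suc Fin.zero) (idx k)

  a≢b : ∀ i j → a i ≢ b j
  a≢b i j eq with combine-injectiveˡ {2} {N} Fin.zero (idx i) (Fin.suc Fin.zero) (idx j) eq
  ... | ()

  a≢a-suc : ∀ k → a k ≢ a (suc k)
  a≢a-suc k eq = idx-suc-≢ k (combine-injectiveʳ {2} {N} Fin.zero (idx k) Fin.zero (idx (suc k)) eq)

  outer-edge : ∀ k → T (prism (a k) (a (suc k)))
  outer-edge k = subst T (sym (□-combine K₂ (C N) Fin.zero Fin.zero (idx k) (idx (suc k))))
    (Equivalence.from T-∨ (inj₁ (Equivalence.from T-∨ (inj₁
      (≡⇒≡ᵇ _ _ (toℕ-idx-suc k))))))

  rung : ∀ k → T (prism (a k) (b k))
  rung k = subst T (sym (□-combine K₂ (C N) Fin.zero (Fin.suc Fin.zero) (idx k) (idx k)))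
    (fromWitness refl)

  no-diagonal : ∀ i j → idx i ≢ idx j → ¬ T (prism (a i) (b j))
  no-diagonal i j i≢j adj =
    i≢j (toWitness (subst T (□-combine K₂ (C N) Fin.zero (Fin.suc Fin.zero) (idx i) (idx j)) adj))

  before-rung : ∀ k → ¬ T (prism (a k) (b (suc k)))
  before-rung k = no-diagonal k (suc k) (idx-suc-≢ k)

  after-rung : ∀ k → ¬ T (prism (a (suc (suc k))) (b (suc k)))
  after-rung k = no-diagonal (suc (suc k)) (suc k) (idx-suc-≢ (suc k) ∘ sym)

  module _ (real : TransitiveRealisation prism) where
    open TransitiveRealisation real

    forward : ℕ → Bool
    forward k = R (a k) (a (suc k))

    backward : ∀ k → ¬ T (forward k) → T (R (a (suc k)) (a k))
    backward k ¬fwd with adjacent⇒comparable (a≢a-suc k) (outer-edge k)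
    ... | inj₁ fwd = ⊥-elim (¬fwd fwd)
    ... | inj₂ bwd = bwd

    -- The path aₖ – aₖ₊₁ – aₖ₊₂ cannot be directed, in either sense,
    -- because of the rung vertex bₖ₊₁.
    no-forward-pair : ∀ k → T (forward k) → T (forward (suc k)) → ⊥
    no-forward-pair k =
      no-directed-path (a≢b k (suc k)) (a≢b (suc k) (suc k)) (a≢b (suc (suc k)) (suc k))
                       (before-rung k) (rung (suc k)) (after-rung k)

    no-backward-pair : ∀ k → T (R (a (suc k)) (a k)) → T (R (a (suc (suc k))) (a (suc k))) → ⊥
    no-backward-pair k bwd₀ bwd₁ =
      no-directed-path (a≢b (suc (suc k)) (suc k)) (a≢b (suc k) (suc k)) (a≢b k (suc k))
                       (after-rung k) (rung (suc k)) (before-rung k) bwd₁ bwd₀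

    forward-alternates : Alternating forward
    forward-alternates k with forward k in f₀ | forward (suc k) in f₁
    ... | true  | true  = ⊥-elim (no-forward-pair k (Equivalence.from T-≡ f₀) (Equivalence.from T-≡ f₁))
    ... | true  | false = refl
    ... | false | true  = refl
    ... | false | false =
      ⊥-elim (no-backward-pair k (backward k (false-of f₀)) (backward (suc k) (false-of f₁)))
      where
      false-of : ∀ {c} → c ≡ false → ¬ T c
      false-of c≡false = subst T c≡false

    forward-periodic : forward N ≡ forward 0
    forward-periodic = cong₂ R (cong (combine {2} {N} Fin.zero) (idx-periodic 0))
                               (cong (combine {2} {N} Fin.zero) (idx-periodic 1))

  no-realisation-if-odd : ∀ j → N ≡ 1 + 2 * j → ¬ TransitiveRealisation prism
  no-realisation-if-odd j N≡odd real =
    alternating-no-odd-period (forward real) (forward-alternates real) j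
      (trans (cong (forward real) (sym N≡odd)) (forward-periodic real))

lemma3p2 : (n : ℕ) → 3 ≤ n → (∃ λ k → n ≡ 1 + 2 * k) →
    τ̄ (K₂ □ C n) ≡ 0
lemma3p2 (suc (suc n')) (s≤s (s≤s (s≤s _))) (j , n≡odd) =
  τ̄-of-non-comparability (K₂ □ C (suc (suc n'))) (Prism.no-realisation-if-odd n' j n≡odd)
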